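{- Let $n$ be a positive integer and $\mathbf{x}_0=(x_0,y_0,z_0)\in\mathrm{ASM}_n$. Then the principal order ideal is \[ \Lambda_{\mathbf{x}_0}=\{(x,y,z)\in\mathbb{Z}_{\ge0}^3 : x\ge x_0,\ y\ge y_0,\ z\le z_0,\ x_0+y_0+z_0\le x+y+z\le n-2\}. \] For $(r,s)\in Y_n$, let $\Lambda_{\mathbf{x}_0}(r,s)=\{\mathbf{x}\in\Lambda_{\mathbf{x}_0}:\pi_1(\mathbf{x})=r,\ \pi_2(\mathbf{x})=s\}$. Then $\Lambda_{\mathbf{x}_0}(r,s)$ is nonempty if and only if $(r,s)\in R_n(\pi_1(\mathbf{x}_0),\pi_2(\mathbf{x}_0))$, where \[ R_n(r_0,s_0):=\{(r,s)\in Y_n : 0\le s\le s_0,\ 0\le r-s\le r_0-s_0\}. \] Moreover, for each $(r,s)\in R_n(\pi_1(\mathbf{x}_0),\pi_2(\mathbf{x}_0))$, \[ |\Lambda_{\mathbf{x}_0}(r,s)|=\pi_1(\mathbf{x}_0)-r+1, \] which in particular does not depend on $s$.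
   Context: $\mathrm{ASM}_n=\{(x,y,z)\in\mathbb{Z}_{\ge0}^3 : x+y+z\le n-2\}$, partially ordered by $(x,y,z)\le(x_0,y_0,z_0)$ iff $x\ge x_0$, $y\ge y_0$, $z\le z_0$ and $x+y+z\ge x_0+y_0+z_0$. For $\mathbf{x}\in\mathrm{ASM}_n$, $\Lambda_{\mathbf{x}}=\{\mathbf{y}\in\mathrm{ASM}_n:\mathbf{y}\le\mathbf{x}\}$. $Y_n=\{(r,s)\in\mathbb{Z}^2:0\le s\le r\le n-2\}$, and $\pi:\mathrm{ASM}_n\to Y_n$, $\pi(x,y,z)=(n-2-(x+y),z)$, with coordinates $\pi_1(x,y,z)=n-2-(x+y)$ and $\pi_2(x,y,z)=z$. -}

module Defs where

open import Data.Nat using (ℕ; _+_; _∸_; _≤_; _≥_)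
open import Data.Product using (_×_; _,_)
open import Relation.Binary.PropositionalEquality using (_≡_)

Triple : Set
Triple = ℕ × ℕ × ℕ

-- ASM_n : x + y + z ≤ n - 2 (integer subtraction; written as +2 to avoid truncation)
InASM : ℕ → Triple → Set
InASM n (x , y , z) = x + y + z + 2 ≤ n

_≼_ : Triple → Triple → Set
(x , y , z) ≼ (x₀ , y₀ , z₀) = x ≥ x₀ × y ≥ y₀ × z ≤ z₀ × x + y + z ≥ x₀ + y₀ + z₀

InΛ : ℕ → Triple → Triple → Set
InΛ n x₀ x = InASM n x × x ≼ x₀

InY : ℕ → ℕ → ℕ → Set
InY n r s = s ≤ r × r + 2 ≤ n

-- π₁(x,y,z) = n - 2 - (x + y), π₂(x,y,z) = z  (used only on ASM_n, where no truncation occurs)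
π₁ : ℕ → Triple → ℕ
π₁ n (x , y , z) = (n ∸ 2) ∸ (x + y)

π₂ : Triple → ℕ
π₂ (x , y , z) = z

-- R_n(r₀,s₀) = { (r,s) ∈ Y_n : 0 ≤ s ≤ s₀, 0 ≤ r - s ≤ r₀ - s₀ }
-- (r - s and r₀ - s₀ are nonnegative in all uses: s ≤ r is required, and s₀ ≤ r₀ for π(x₀), x₀ ∈ ASM_n)
InR : ℕ → ℕ → ℕ → ℕ → ℕ → Set
InR n r₀ s₀ r s = InY n r s × s ≤ s₀ × s ≤ r × r ∸ s ≤ r₀ ∸ s₀

InFiber : ℕ → Triple → ℕ → ℕ → Triple → Set
InFiber n x₀ r s x = InΛ n x₀ x × π₁ n x ≡ r × π₂ x ≡ s

-- Write a₀ = x₀ + y₀ and r₀ = π₁(x₀) = n - 2 - a₀.  A point (x, y, z) of Λ_{x₀} lies over (r, s)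
-- exactly when z = s and x + y = a₀ + m with m = r₀ - r, so writing x = x₀ + p, y = y₀ + q the
-- fibre is the antidiagonal p + q = m, which has m + 1 points.  The remaining constraints,
-- s ≤ r, s ≤ z₀ and z₀ ≤ m + s, are independent of (p, q); together they are the condition
-- (r, s) ∈ R_n(r₀, z₀), i.e. r - s ≤ r₀ - z₀.
module Submission where

open import Defs
open import Data.Nat using (ℕ; _+_; _∸_; _≤_; _≥_; _<_; z≤n; s≤s; s≤s⁻¹)
open import Data.Nat.Properties
open import Data.Fin using (Fin; toℕ; fromℕ<)
open import Data.Fin.Properties using (toℕ-injective; toℕ-fromℕ<; toℕ<n)
open import Data.Product using (Σ; ∃; _×_; _,_; proj₁; proj₂)
open import Function.Bundles using (_⇔_; _↔_; mk⇔; mk↔ₛ′; Inverse)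
open import Function.Properties.Inverse using (↔-trans)
open import Relation.Nullary using (Irrelevant)
open import Relation.Binary.PropositionalEquality
open import Algebra.Properties.CommutativeSemigroup +-commutativeSemigroup using (interchange)

Σ-≡-irrelevant : {A : Set} {P : A → Set} → (∀ {a} → Irrelevant (P a)) →
                 {u v : Σ A P} → proj₁ u ≡ proj₁ v → u ≡ v
Σ-≡-irrelevant irr {a , p} {.a , q} refl = cong (a ,_) (irr p q)

m<n+1⇒m≤n : ∀ {m n} → m < n + 1 → m ≤ n
m<n+1⇒m≤n {m} {n} h = m<1+n⇒m≤n (subst (m <_) (+-comm n 1) h)

m≤n⇒m<n+1 : ∀ {m n} → m ≤ n → m < n + 1
m≤n⇒m<n+1 {m} {n} h = subst (m <_) (+-comm 1 n) (s≤s h)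

m+2≤2+n⇒m≤n : ∀ {m n} → m + 2 ≤ 2 + n → m ≤ n
m+2≤2+n⇒m≤n {m} {n} h = s≤s⁻¹ (s≤s⁻¹ (subst (_≤ 2 + n) (+-comm m 2) h))

m≤n⇒m+2≤2+n : ∀ {m n} → m ≤ n → m + 2 ≤ 2 + n
m≤n⇒m+2≤2+n {m} {n} h = subst (_≤ 2 + n) (+-comm 2 m) (s≤s (s≤s h))

n∸m≡o⇒m+o≡n : ∀ {m n o} → m ≤ n → n ∸ m ≡ o → m + o ≡ n
n∸m≡o⇒m+o≡n {m} m≤n refl = m+[n∸m]≡n m≤n

∸-slack⇒ : ∀ {c r₀ s r} → c ≤ r₀ → s ≤ c → s ≤ r → r ∸ s ≤ r₀ ∸ c → r ≤ r₀ × c ≤ (r₀ ∸ r) + s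
∸-slack⇒ {c} {r₀} {s} {r} c≤r₀ s≤c s≤r h = m+n≤o⇒m≤o r r+[c∸s]≤r₀ , c≤[r₀∸r]+s
  where
  open ≤-Reasoning
  r+[c∸s]≤r₀ : r + (c ∸ s) ≤ r₀
  r+[c∸s]≤r₀ = begin
    r + (c ∸ s)           ≡⟨ cong (_+ (c ∸ s)) (m∸n+n≡m s≤r) ⟨
    r ∸ s + s + (c ∸ s)   ≡⟨ +-assoc (r ∸ s) s (c ∸ s) ⟩
    r ∸ s + (s + (c ∸ s)) ≡⟨ cong (r ∸ s +_) (m+[n∸m]≡n s≤c) ⟩
    r ∸ s + c             ≤⟨ m≤o∸n⇒m+n≤o (r ∸ s) c≤r₀ h ⟩
    r₀                    ∎
  c≤[r₀∸r]+s : c ≤ (r₀ ∸ r) + s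
  c≤[r₀∸r]+s = begin
    c           ≡⟨ m∸n+n≡m s≤c ⟨
    c ∸ s + s   ≤⟨ +-monoˡ-≤ s (m+n≤o⇒m≤o∸n (c ∸ s) (subst (_≤ r₀) (+-comm r (c ∸ s)) r+[c∸s]≤r₀)) ⟩
    r₀ ∸ r + s  ∎

∸-slack⇐ : ∀ {c m s r} → c ≤ m + s → r ∸ s ≤ (m + r) ∸ c
∸-slack⇐ {c} {m} {s} {r} h = begin
  r ∸ s             ≡⟨ [m+n]∸[m+o]≡n∸o m r s ⟨
  (m + r) ∸ (m + s) ≤⟨ ∸-monoʳ-≤ (m + r) h ⟩
  (m + r) ∸ c       ∎
  where open ≤-Reasoning

Antidiagonal : ℕ → Set
Antidiagonal m = Σ (ℕ × ℕ) (λ (p , q) → p + q ≡ m)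

Fin↔Antidiagonal : ∀ m → Fin (m + 1) ↔ Antidiagonal m
Fin↔Antidiagonal m = mk↔ₛ′ to from to∘from from∘to
  where
  to : Fin (m + 1) → Antidiagonal m
  to k = (toℕ k , m ∸ toℕ k) , m+[n∸m]≡n (m<n+1⇒m≤n (toℕ<n k))
  from : Antidiagonal m → Fin (m + 1)
  from ((p , q) , p+q≡m) = fromℕ< (m≤n⇒m<n+1 (subst (p ≤_) p+q≡m (m≤m+n p q)))
  to∘from : ∀ d → to (from d) ≡ d
  to∘from ((p , q) , p+q≡m) = Σ-≡-irrelevant ≡-irrelevant
    (cong₂ _,_ toℕ-from≡p (trans (cong (m ∸_) toℕ-from≡p) (trans (cong (_∸ p) (sym p+q≡m)) (m+n∸m≡n p q))))
    where
    toℕ-from≡p : toℕ (from ((p , q) , p+q≡m)) ≡ p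
    toℕ-from≡p = toℕ-fromℕ< _
  from∘to : ∀ k → from (to k) ≡ k
  from∘to k = toℕ-injective (toℕ-fromℕ< _)

InFiber-irrelevant : ∀ {n r s} x₀ y₀ z₀ x y z → Irrelevant (InFiber n (x₀ , y₀ , z₀) r s (x , y , z))
InFiber-irrelevant _ _ _ _ _ _ ((a , b , c , d , e) , f , g) ((a′ , b′ , c′ , d′ , e′) , f′ , g′)
  rewrite ≤-irrelevant a a′ | ≤-irrelevant b b′ | ≤-irrelevant c c′ | ≤-irrelevant d d′
        | ≤-irrelevant e e′ | ≡-irrelevant f f′ | ≡-irrelevant g g′ = refl

InΛ⇔bounds : ∀ n x₀ y₀ z₀ x y z → InΛ n (x₀ , y₀ , z₀) (x , y , z)
    ⇔ (x ≥ x₀ × y ≥ y₀ × z ≤ z₀ × x₀ + y₀ + z₀ ≤ x + y + z × x + y + z + 2 ≤ n)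
InΛ⇔bounds _ _ _ _ _ _ _ = mk⇔ (λ (asm , x≥ , y≥ , z≤ , sum≥) → x≥ , y≥ , z≤ , sum≥ , asm)
                               (λ (x≥ , y≥ , z≤ , sum≥ , asm) → asm , x≥ , y≥ , z≤ , sum≥)

module Fibres (N x₀ y₀ z₀ : ℕ) (x₀∈ASM : x₀ + y₀ + z₀ ≤ N) where

  r₀ : ℕ
  r₀ = N ∸ (x₀ + y₀)

  Fibre : ℕ → ℕ → Set
  Fibre r s = Σ Triple (InFiber (2 + N) (x₀ , y₀ , z₀) r s)

  fibre-level : ∀ {r s x y z} → InFiber (2 + N) (x₀ , y₀ , z₀) r s (x , y , z) → x + y + r ≡ N
  fibre-level {x = x} {y} ((x∈ASM , _) , π₁≡r , _) =
    n∸m≡o⇒m+o≡n (m+n≤o⇒m≤o (x + y) (m+2≤2+n⇒m≤n x∈ASM)) π₁≡r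

  module _ {r s m : ℕ} (level : x₀ + y₀ + m + r ≡ N) (s≤r : s ≤ r) (s≤z₀ : s ≤ z₀) (z₀≤m+s : z₀ ≤ m + s) where

    antidiagonal∈fibre : ∀ {p q} → p + q ≡ m → InFiber (2 + N) (x₀ , y₀ , z₀) r s (x₀ + p , y₀ + q , s)
    antidiagonal∈fibre {p} {q} refl rewrite interchange x₀ p y₀ q | sym level =
      (m≤n⇒m+2≤2+n (+-monoʳ-≤ (x₀ + y₀ + (p + q)) s≤r) , m≤m+n x₀ p , m≤m+n y₀ q , s≤z₀ ,
        subst (x₀ + y₀ + z₀ ≤_) (sym (+-assoc (x₀ + y₀) (p + q) s)) (+-monoʳ-≤ (x₀ + y₀) z₀≤m+s))
      , m+n∸m≡n (x₀ + y₀ + (p + q)) r , refl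

    fibre∈antidiagonal : ∀ {x y z} → InFiber (2 + N) (x₀ , y₀ , z₀) r s (x , y , z) →
                         (x ∸ x₀) + (y ∸ y₀) ≡ m
    fibre∈antidiagonal {x} {y} f@((_ , x₀≤x , y₀≤y , _) , _) =
      +-cancelˡ-≡ (x₀ + y₀) _ _ (+-cancelʳ-≡ r _ _ (begin
        x₀ + y₀ + (x ∸ x₀ + (y ∸ y₀)) + r   ≡⟨ cong (_+ r) (interchange x₀ (x ∸ x₀) y₀ (y ∸ y₀)) ⟨
        x₀ + (x ∸ x₀) + (y₀ + (y ∸ y₀)) + r ≡⟨ cong₂ (λ u v → u + v + r) (m+[n∸m]≡n x₀≤x) (m+[n∸m]≡n y₀≤y) ⟩
        x + y + r                           ≡⟨ trans (fibre-level f) (sym level) ⟩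
        x₀ + y₀ + m + r                     ∎))
      where open ≡-Reasoning

    Antidiagonal↔Fibre : Antidiagonal m ↔ Fibre r s
    Antidiagonal↔Fibre = mk↔ₛ′ to from to∘from from∘to
      where
      to : Antidiagonal m → Fibre r s
      to ((p , q) , p+q≡m) = (x₀ + p , y₀ + q , s) , antidiagonal∈fibre p+q≡m
      from : Fibre r s → Antidiagonal m
      from ((x , y , z) , f) = (x ∸ x₀ , y ∸ y₀) , fibre∈antidiagonal f
      to∘from : ∀ t → to (from t) ≡ t
      to∘from ((x , y , z) , f@((_ , x₀≤x , y₀≤y , _) , _ , z≡s)) =
        Σ-≡-irrelevant (InFiber-irrelevant x₀ y₀ z₀ _ _ _)
          (cong₂ _,_ (m+[n∸m]≡n x₀≤x) (cong₂ _,_ (m+[n∸m]≡n y₀≤y) (sym z≡s)))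
      from∘to : ∀ d → from (to d) ≡ d
      from∘to ((p , q) , _) = Σ-≡-irrelevant ≡-irrelevant (cong₂ _,_ (m+n∸m≡n x₀ p) (m+n∸m≡n y₀ q))

  fibre-count : ∀ r s → InR (2 + N) r₀ z₀ r s → Fin (r₀ ∸ r + 1) ↔ Fibre r s
  fibre-count r s ((s≤r , _) , s≤z₀ , _ , slack) =
    ↔-trans (Fin↔Antidiagonal (r₀ ∸ r)) (Antidiagonal↔Fibre level s≤r s≤z₀ z₀≤[r₀∸r]+s)
    where
    z₀≤r₀ : z₀ ≤ r₀
    z₀≤r₀ = m+n≤o⇒m≤o∸n z₀ (subst (_≤ N) (+-comm (x₀ + y₀) z₀) x₀∈ASM)
    r≤r₀ : r ≤ r₀
    r≤r₀ = proj₁ (∸-slack⇒ z₀≤r₀ s≤z₀ s≤r slack)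
    z₀≤[r₀∸r]+s : z₀ ≤ (r₀ ∸ r) + s
    z₀≤[r₀∸r]+s = proj₂ (∸-slack⇒ z₀≤r₀ s≤z₀ s≤r slack)
    level : x₀ + y₀ + (r₀ ∸ r) + r ≡ N
    level = trans (+-assoc (x₀ + y₀) (r₀ ∸ r) r)
              (trans (cong (x₀ + y₀ +_) (m∸n+n≡m r≤r₀)) (m+[n∸m]≡n (m+n≤o⇒m≤o (x₀ + y₀) x₀∈ASM)))

  fibre⇒InR : ∀ r s → InY (2 + N) r s → Fibre r s → InR (2 + N) r₀ z₀ r s
  fibre⇒InR r s Y ((x , y , z) , f@((_ , x₀≤x , y₀≤y , z≤z₀ , above) , _ , refl)) =
    Y , z≤z₀ , proj₁ Y , subst (λ t → r ∸ z ≤ t ∸ z₀) (sym r₀≡m+r) (∸-slack⇐ {m = m} {r = r} z₀≤m+z)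
    where
    m : ℕ
    m = (x + y) ∸ (x₀ + y₀)
    x₀+y₀+m≡x+y : x₀ + y₀ + m ≡ x + y
    x₀+y₀+m≡x+y = m+[n∸m]≡n (+-mono-≤ x₀≤x y₀≤y)
    r₀≡m+r : r₀ ≡ m + r
    r₀≡m+r = begin
      N ∸ (x₀ + y₀)                   ≡⟨ cong (_∸ (x₀ + y₀)) (fibre-level f) ⟨
      x + y + r ∸ (x₀ + y₀)           ≡⟨ cong (λ t → t + r ∸ (x₀ + y₀)) x₀+y₀+m≡x+y ⟨
      x₀ + y₀ + m + r ∸ (x₀ + y₀)     ≡⟨ cong (_∸ (x₀ + y₀)) (+-assoc (x₀ + y₀) m r) ⟩
      x₀ + y₀ + (m + r) ∸ (x₀ + y₀)   ≡⟨ m+n∸m≡n (x₀ + y₀) (m + r) ⟩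
      m + r                           ∎
      where open ≡-Reasoning
    z₀≤m+z : z₀ ≤ m + z
    z₀≤m+z = +-cancelˡ-≤ (x₀ + y₀) z₀ (m + z)
      (subst (x₀ + y₀ + z₀ ≤_) (trans (cong (_+ z) (sym x₀+y₀+m≡x+y)) (+-assoc (x₀ + y₀) m z)) above)

  fibre-nonempty⇔InR : ∀ r s → InY (2 + N) r s → Fibre r s ⇔ InR (2 + N) r₀ z₀ r s
  fibre-nonempty⇔InR r s Y =
    mk⇔ (fibre⇒InR r s Y) (λ R → Inverse.to (fibre-count r s R) (fromℕ< (m≤n⇒m<n+1 z≤n)))

mainTheorem6 : (n : ℕ) → 1 ≤ n → (x₀ y₀ z₀ : ℕ) → InASM n (x₀ , y₀ , z₀) →
    ((x y z : ℕ) → InΛ n (x₀ , y₀ , z₀) (x , y , z)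
        ⇔ (x ≥ x₀ × y ≥ y₀ × z ≤ z₀ × x₀ + y₀ + z₀ ≤ x + y + z × x + y + z + 2 ≤ n))
    × ((r s : ℕ) → InY n r s →
        (∃ (InFiber n (x₀ , y₀ , z₀) r s)
          ⇔ InR n (π₁ n (x₀ , y₀ , z₀)) (π₂ (x₀ , y₀ , z₀)) r s))
    × ((r s : ℕ) → InR n (π₁ n (x₀ , y₀ , z₀)) (π₂ (x₀ , y₀ , z₀)) r s →
        Fin (π₁ n (x₀ , y₀ , z₀) ∸ r + 1) ↔ Σ Triple (InFiber n (x₀ , y₀ , z₀) r s))
mainTheorem6 n _ x₀ y₀ z₀ x₀∈ASM with m+n≤o⇒n≤o (x₀ + y₀ + z₀) x₀∈ASM
... | s≤s (s≤s {n = N} _) = InΛ⇔bounds n x₀ y₀ z₀ , fibre-nonempty⇔InR , fibre-count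
  where open Fibres N x₀ y₀ z₀ (m+2≤2+n⇒m≤n x₀∈ASM)
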